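{- Let $B=(1,2,1)$, $A=\mathrm{diag}(2,3,5)$, and $\mathrm{NT}=\{\vec{x}\in\mathbb{R}^3 : BA^k\vec{x}\ge 0 \ \forall k\ge 0\}$. Let $\tau=\{(x_1,x_2,x_3)\in\mathbb{R}^3 : 9(x_1^2+x_2^2)-x_3^2<0,\ x_3>0\}$. Then $\tau\subseteq\mathrm{NT}$.
   Context: $\mathrm{NT}$ is the non-termination set of the loop $\mathrm{while}\ (x_1+2x_2+x_3\ge 0)\ \{(x_1,x_2,x_3):=(2x_1,3x_2,5x_3)\}$. -}

module Defs where

open import Level using (Level; _⊔_; suc)
open import Data.Nat using (ℕ; zero) renaming (suc to sucℕ)
open import Data.Product using (Σ; ∃; _×_; _,_)
open import Relation.Nullary using (¬_)
open import Relation.Binary using (Rel; IsTotalOrder)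
open import Algebra.Bundles using (CommutativeRing)

-- The real numbers, characterised axiomatically as a Dedekind-complete
-- ordered field (this determines ℝ up to isomorphism).
record RealField (c ℓ₁ ℓ₂ : Level) : Set (Level.suc (c ⊔ ℓ₁ ⊔ ℓ₂)) where
  field
    commRing : CommutativeRing c ℓ₁
  open CommutativeRing commRing public
  field
    _≤_ : Rel Carrier ℓ₂
    ≤-isTotalOrder : IsTotalOrder _≈_ _≤_
    0≉1 : ¬ (0# ≈ 1#)
    inverse : ∀ x → ¬ (x ≈ 0#) → Σ Carrier λ y → (x * y) ≈ 1#
    +-monoˡ-≤ : ∀ {x y} z → x ≤ y → (x + z) ≤ (y + z)
    *-nonneg : ∀ {x y} → 0# ≤ x → 0# ≤ y → 0# ≤ (x * y)
  _<_ : Rel Carrier (ℓ₁ ⊔ ℓ₂)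
  x < y = (x ≤ y) × ¬ (x ≈ y)
  IsUpperBound : (Carrier → Set c) → Carrier → Set (c ⊔ ℓ₂)
  IsUpperBound P u = ∀ x → P x → x ≤ u
  field
    sup : (P : Carrier → Set c) → Σ Carrier P → Σ Carrier (IsUpperBound P) →
          Σ Carrier λ s → IsUpperBound P s × (∀ u → IsUpperBound P u → s ≤ u)

module Loop {c ℓ₁ ℓ₂ : Level} (R : RealField c ℓ₁ ℓ₂) where
  open RealField R

  ⟦_⟧ : ℕ → Carrier
  ⟦ zero ⟧ = 0#
  ⟦ sucℕ n ⟧ = 1# + ⟦ n ⟧

  ℝ³ : Set c
  ℝ³ = Carrier × Carrier × Carrier

  A : ℝ³ → ℝ³
  A (x₁ , x₂ , x₃) = (⟦ 2 ⟧ * x₁ , ⟦ 3 ⟧ * x₂ , ⟦ 5 ⟧ * x₃)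

  A^ : ℕ → ℝ³ → ℝ³
  A^ zero x = x
  A^ (sucℕ k) x = A (A^ k x)

  B : ℝ³ → Carrier
  B (x₁ , x₂ , x₃) = x₁ + (⟦ 2 ⟧ * x₂) + x₃

  NT : ℝ³ → Set ℓ₂
  NT x = ∀ (k : ℕ) → 0# ≤ B (A^ k x)

  τ : ℝ³ → Set (ℓ₁ ⊔ ℓ₂)
  τ (x₁ , x₂ , x₃) =
    ((⟦ 9 ⟧ * ((x₁ * x₁) + (x₂ * x₂))) - (x₃ * x₃)) < 0#  ×  0# < x₃

-- The proof exhibits τ as an invariant set contained in the loop guard:
--   * τ is mapped into itself by A = diag(2,3,5), because
--       9((2x₁)² + (3x₂)²) ≤ 9·9(x₁² + x₂²) < 9x₃² ≤ (5x₃)²;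
--   * on τ we have (3x₁)² < x₃² and (3x₂)² < x₃², hence 3x₁ + x₃ ≥ 0 and
--     3x₂ + x₃ ≥ 0, and so 3·B x = (3x₁ + x₃) + 2(3x₂ + x₃) ≥ 0.
-- Therefore every iterate Aᵏ x of a point x ∈ τ stays in τ and satisfies
-- the guard, i.e. x ∈ NT.

module Submission where

open import Defs
open import Level using (Level)
open import Data.Nat using (ℕ; zero; suc)
open import Data.Product using (_×_; _,_; proj₁; proj₂)
open import Data.Sum using (inj₁; inj₂)
open import Data.Empty using (⊥-elim)
open import Relation.Binary.Bundles using (TotalOrder)

module OrderedFieldFacts {c ℓ₁ ℓ₂ : Level} (R : RealField c ℓ₁ ℓ₂) where
  open RealField R hiding (_≤_; _<_)
  open import Relation.Binary using (Rel)

  -- The order relations of R, re-exported with the usual fixity so that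
  -- arithmetic expressions on either side parse without parentheses.
  infix 4 _≤_ _<_
  _≤_ : Rel Carrier ℓ₂
  _≤_ = RealField._≤_ R
  _<_ : Rel Carrier (ℓ₁ Level.⊔ ℓ₂)
  _<_ = RealField._<_ R

  open Loop R using (⟦_⟧)
  open import Algebra.Properties.Group +-group using (//-rightDividesˡ; ∙-cancelʳ; ⁻¹-involutive)
  open import Algebra.Properties.AbelianGroup +-abelianGroup using (xyx⁻¹≈y)
  open import Algebra.Properties.Ring ring using (-‿distribˡ-*; -‿distribʳ-*)

  totalOrder : TotalOrder c ℓ₁ ℓ₂
  totalOrder = record { isTotalOrder = ≤-isTotalOrder }

  open TotalOrder totalOrder public
    using (total; antisym; poset) renaming (refl to ≤-refl; trans to ≤-trans)
  open import Relation.Binary.Reasoning.PartialOrder poset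

  +-monoʳ-≤ : ∀ z {x y} → x ≤ y → z + x ≤ z + y
  +-monoʳ-≤ z {x} {y} x≤y = begin
    z + x  ≈⟨ +-comm z x ⟩
    x + z  ≤⟨ +-monoˡ-≤ z x≤y ⟩
    y + z  ≈⟨ +-comm y z ⟩
    z + y  ∎

  x≤x+y : ∀ {x y} → 0# ≤ y → x ≤ x + y
  x≤x+y {x} {y} 0≤y = begin
    x       ≈⟨ +-identityˡ x ⟨
    0# + x  ≤⟨ +-monoˡ-≤ x 0≤y ⟩
    y + x   ≈⟨ +-comm y x ⟩
    x + y   ∎

  +-nonneg : ∀ {x y} → 0# ≤ x → 0# ≤ y → 0# ≤ x + y
  +-nonneg {x} {y} 0≤x 0≤y = begin
    0#     ≤⟨ 0≤x ⟩
    x      ≤⟨ x≤x+y 0≤y ⟩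
    x + y  ∎

  +-monoˡ-< : ∀ z {x y} → x < y → x + z < y + z
  +-monoˡ-< z {x} {y} (x≤y , x≉y) =
    +-monoˡ-≤ z x≤y , λ eq → x≉y (∙-cancelʳ z x y eq)

  +-mono-< : ∀ {x y u v} → x < y → u < v → x + u < y + v
  +-mono-< {x} {y} {u} {v} x<y u<v = begin-strict
    x + u  <⟨ +-monoˡ-< u x<y ⟩
    y + u  ≤⟨ +-monoʳ-≤ y (proj₁ u<v) ⟩
    y + v  ∎

  -- Comparisons with a difference: ≤⇒0≤- reduces monotonicity of * to the
  -- axiom *-nonneg; the strict pair reads and writes the form
  -- 9(x₁² + x₂²) - x₃² < 0 in which τ is stated.
  ≤⇒0≤- : ∀ {x y} → x ≤ y → 0# ≤ y - x
  ≤⇒0≤- {x} {y} x≤y = begin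
    0#     ≈⟨ -‿inverseʳ x ⟨
    x - x  ≤⟨ +-monoˡ-≤ (- x) x≤y ⟩
    y - x  ∎

  -<0⇒< : ∀ {x y} → x - y < 0# → x < y
  -<0⇒< {x} {y} x-y<0 = begin-strict
    x            ≈⟨ //-rightDividesˡ y x ⟨
    (x - y) + y  <⟨ +-monoˡ-< y x-y<0 ⟩
    0# + y       ≈⟨ +-identityˡ y ⟩
    y            ∎

  <⇒-<0 : ∀ {x y} → x < y → x - y < 0#
  <⇒-<0 {x} {y} x<y = begin-strict
    x - y  <⟨ +-monoˡ-< (- y) x<y ⟩
    y - y  ≈⟨ -‿inverseʳ y ⟩
    0#     ∎

  -- Multiplication by a nonnegative element is monotone: w(y - x) ≥ 0.
  *-monoˡ-≤ : ∀ {w x y} → 0# ≤ w → x ≤ y → w * x ≤ w * y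
  *-monoˡ-≤ {w} {x} {y} 0≤w x≤y = begin
    w * x                ≈⟨ +-identityˡ (w * x) ⟨
    0# + w * x           ≤⟨ +-monoˡ-≤ (w * x) (*-nonneg 0≤w (≤⇒0≤- x≤y)) ⟩
    w * (y - x) + w * x  ≈⟨ distribˡ w (y - x) x ⟨
    w * ((y - x) + x)    ≈⟨ *-congˡ (//-rightDividesˡ x y) ⟩
    w * y                ∎

  neg-square : ∀ x → - x * - x ≈ x * x
  neg-square x = begin-equality
    - x * - x        ≈⟨ -‿distribˡ-* x (- x) ⟨
    - (x * - x)      ≈⟨ -‿cong (-‿distribʳ-* x x) ⟨
    - (- (x * x))    ≈⟨ ⁻¹-involutive (x * x) ⟩
    x * x            ∎

  square-nonneg : ∀ x → 0# ≤ x * x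
  square-nonneg x with total 0# x
  ... | inj₁ 0≤x = *-nonneg 0≤x 0≤x
  ... | inj₂ x≤0 = begin
    0#         ≤⟨ *-nonneg 0≤-x 0≤-x ⟩
    - x * - x  ≈⟨ neg-square x ⟩
    x * x      ∎
    where
      0≤-x : 0# ≤ - x
      0≤-x = begin
        0#      ≤⟨ ≤⇒0≤- x≤0 ⟩
        0# - x  ≈⟨ +-identityˡ (- x) ⟩
        - x     ∎

  square-mono : ∀ {x y} → 0# ≤ x → x ≤ y → x * x ≤ y * y
  square-mono {x} {y} 0≤x x≤y = begin
    x * x  ≤⟨ *-monoˡ-≤ 0≤x x≤y ⟩
    x * y  ≈⟨ *-comm x y ⟩
    y * x  ≤⟨ *-monoˡ-≤ (≤-trans 0≤x x≤y) x≤y ⟩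
    y * y  ∎

  -- If 0 ≤ z and x² < z² then -x < z, so in particular x + z ≥ 0:
  -- otherwise z ≤ -x would give z² ≤ x².
  square<⇒sum-nonneg : ∀ {x z} → 0# ≤ z → x * x < z * z → 0# ≤ x + z
  square<⇒sum-nonneg {x} {z} 0≤z (x²≤z² , x²≉z²) with total 0# (x + z)
  ... | inj₁ 0≤x+z = 0≤x+z
  ... | inj₂ x+z≤0 = ⊥-elim (x²≉z² (antisym x²≤z² z²≤x²))
    where
      z≤-x : z ≤ - x
      z≤-x = begin
        z             ≈⟨ xyx⁻¹≈y x z ⟨
        (x + z) - x   ≤⟨ +-monoˡ-≤ (- x) x+z≤0 ⟩
        0# - x        ≈⟨ +-identityˡ (- x) ⟩
        - x           ∎
      z²≤x² : z * z ≤ x * x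
      z²≤x² = begin
        z * z      ≤⟨ square-mono 0≤z z≤-x ⟩
        - x * - x  ≈⟨ neg-square x ⟩
        x * x      ∎

  numeral-step : ∀ n x → ⟦ suc n ⟧ * x ≈ x + ⟦ n ⟧ * x
  numeral-step n x = trans (distribʳ x 1# ⟦ n ⟧) (+-congʳ (*-identityˡ x))

  numeral-nonneg : ∀ n → 0# ≤ ⟦ n ⟧
  numeral-nonneg zero = ≤-refl
  numeral-nonneg (suc n) = +-nonneg 0≤1 (numeral-nonneg n)
    where
      0≤1 : 0# ≤ 1#
      0≤1 = begin
        0#       ≤⟨ square-nonneg 1# ⟩
        1# * 1#  ≈⟨ *-identityˡ 1# ⟩
        1#       ∎

  scale-< : ∀ n {x y} → x < y → ⟦ suc n ⟧ * x < ⟦ suc n ⟧ * y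
  scale-< zero {x} {y} x<y = begin-strict
    ⟦ 1 ⟧ * x       ≈⟨ numeral-step 0 x ⟩
    x + 0# * x      ≈⟨ +-congˡ (zeroˡ x) ⟩
    x + 0#          ≈⟨ +-identityʳ x ⟩
    x               <⟨ x<y ⟩
    y               ≈⟨ +-identityʳ y ⟨
    y + 0#          ≈⟨ +-congˡ (zeroˡ y) ⟨
    y + 0# * y      ≈⟨ numeral-step 0 y ⟨
    ⟦ 1 ⟧ * y       ∎
  scale-< (suc n) {x} {y} x<y = begin-strict
    ⟦ suc (suc n) ⟧ * x    ≈⟨ numeral-step (suc n) x ⟩
    x + ⟦ suc n ⟧ * x      <⟨ +-mono-< x<y (scale-< n x<y) ⟩
    y + ⟦ suc n ⟧ * y      ≈⟨ numeral-step (suc n) y ⟨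
    ⟦ suc (suc n) ⟧ * y    ∎

  scale-reflects-nonneg : ∀ n {x} → 0# ≤ ⟦ suc n ⟧ * x → 0# ≤ x
  scale-reflects-nonneg n {x} 0≤nx with total 0# x
  ... | inj₁ 0≤x = 0≤x
  ... | inj₂ x≤0 = begin
    0#                 ≤⟨ 0≤nx ⟩
    ⟦ suc n ⟧ * x      ≈⟨ numeral-step n x ⟩
    x + ⟦ n ⟧ * x      ≤⟨ +-monoʳ-≤ x (*-monoˡ-≤ (numeral-nonneg n) x≤0) ⟩
    x + ⟦ n ⟧ * 0#     ≈⟨ +-congˡ (zeroʳ ⟦ n ⟧) ⟩
    x + 0#             ≈⟨ +-identityʳ x ⟩
    x                  ∎

module Invariance {c ℓ₁ ℓ₂ : Level} (R : RealField c ℓ₁ ℓ₂) where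
  open RealField R hiding (_≤_; _<_)
  open Loop R
  open OrderedFieldFacts R
  open import Relation.Binary.Reasoning.PartialOrder poset
  open import Algebra.Solver.Ring.NaturalCoefficients.Default commutativeSemiring
    using (solve; _:=_; _:+_; _:*_; con; Polynomial)

  invariant⊆NT : ∀ {p} (P : ℝ³ → Set p) → (∀ x → P x → P (A x)) →
                 (∀ x → P x → 0# ≤ B x) → ∀ x → P x → NT x
  invariant⊆NT P P-invariant P⊆guard x x∈P k = P⊆guard (A^ k x) (orbit-in-P k)
    where
      orbit-in-P : ∀ n → P (A^ n x)
      orbit-in-P zero = x∈P
      orbit-in-P (suc n) = P-invariant (A^ n x) (orbit-in-P n)

  N : ∀ {m} → ℕ → Polynomial m
  N zero = con 0
  N (suc n) = con 1 :+ N n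

  -- On τ both 3x₁ + x₃ and 3x₂ + x₃ are nonnegative, since (3xᵢ)² < x₃².
  τ-bounds : ∀ a b z → τ (a , b , z) → (0# ≤ ⟦ 3 ⟧ * a + z) × (0# ≤ ⟦ 3 ⟧ * b + z)
  τ-bounds a b z (S-z²<0 , (0≤z , _)) =
    square<⇒sum-nonneg 0≤z (square-below u w (square-nonneg _) u+w≈S) ,
    square<⇒sum-nonneg 0≤z (square-below w u (square-nonneg _) (trans (+-comm w u) u+w≈S))
    where
      S u w : Carrier
      S = ⟦ 9 ⟧ * ((a * a) + (b * b))
      u = (⟦ 3 ⟧ * a) * (⟦ 3 ⟧ * a)
      w = (⟦ 3 ⟧ * b) * (⟦ 3 ⟧ * b)
      u+w≈S : u + w ≈ S
      u+w≈S = solve 2 (λ a b → (N 3 :* a) :* (N 3 :* a) :+ (N 3 :* b) :* (N 3 :* b)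
                             := N 9 :* (a :* a :+ b :* b)) refl a b
      square-below : ∀ s t → 0# ≤ t → s + t ≈ S → s < z * z
      square-below s t 0≤t s+t≈S = begin-strict
        s      ≤⟨ x≤x+y 0≤t ⟩
        s + t  ≈⟨ s+t≈S ⟩
        S      <⟨ -<0⇒< S-z²<0 ⟩
        z * z  ∎

  -- Since 3·B x = (3x₁ + x₃) + 2(3x₂ + x₃), τ lies inside the guard B x ≥ 0.
  τ⊆guard : ∀ x → τ x → 0# ≤ B x
  τ⊆guard (a , b , z) x∈τ = scale-reflects-nonneg 2 (begin
    0#                                      ≤⟨ +-nonneg 0≤3a+z (*-nonneg (numeral-nonneg 2) 0≤3b+z) ⟩
    (⟦ 3 ⟧ * a + z) + ⟦ 2 ⟧ * (⟦ 3 ⟧ * b + z) ≈⟨ regroup ⟩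
    ⟦ 3 ⟧ * (a + ⟦ 2 ⟧ * b + z)               ∎)
    where
      0≤3a+z : 0# ≤ ⟦ 3 ⟧ * a + z
      0≤3a+z = proj₁ (τ-bounds a b z x∈τ)
      0≤3b+z : 0# ≤ ⟦ 3 ⟧ * b + z
      0≤3b+z = proj₂ (τ-bounds a b z x∈τ)
      regroup : (⟦ 3 ⟧ * a + z) + ⟦ 2 ⟧ * (⟦ 3 ⟧ * b + z) ≈ ⟦ 3 ⟧ * (a + ⟦ 2 ⟧ * b + z)
      regroup = solve 3 (λ a b z → (N 3 :* a :+ z) :+ N 2 :* (N 3 :* b :+ z)
                                := N 3 :* (a :+ N 2 :* b :+ z)) refl a b z

  -- A maps τ into itself:
  --   9((2x₁)² + (3x₂)²) ≤ 9·9(x₁² + x₂²) < 9x₃² ≤ (5x₃)²   and   5x₃ > 0.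
  τ-invariant : ∀ x → τ x → τ (A x)
  τ-invariant (a , b , z) (S-z²<0 , 0<z) = <⇒-<0 T<25z² , 0<5z
    where
      S T : Carrier
      S = ⟦ 9 ⟧ * ((a * a) + (b * b))
      T = ⟦ 9 ⟧ * ((⟦ 2 ⟧ * a) * (⟦ 2 ⟧ * a) + (⟦ 3 ⟧ * b) * (⟦ 3 ⟧ * b))
      T+45a²≈9S : T + ⟦ 45 ⟧ * (a * a) ≈ ⟦ 9 ⟧ * S
      T+45a²≈9S = solve 2 (λ a b → N 9 :* ((N 2 :* a) :* (N 2 :* a) :+ (N 3 :* b) :* (N 3 :* b))
                                     :+ N 45 :* (a :* a)
                                := N 9 :* (N 9 :* (a :* a :+ b :* b))) refl a b
      9z²+16z²≈25z² : ⟦ 9 ⟧ * (z * z) + ⟦ 16 ⟧ * (z * z) ≈ (⟦ 5 ⟧ * z) * (⟦ 5 ⟧ * z)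
      9z²+16z²≈25z² = solve 1 (λ z → N 9 :* (z :* z) :+ N 16 :* (z :* z)
                                   := (N 5 :* z) :* (N 5 :* z)) refl z
      T<25z² : T < (⟦ 5 ⟧ * z) * (⟦ 5 ⟧ * z)
      T<25z² = begin-strict
        T                                ≤⟨ x≤x+y (*-nonneg (numeral-nonneg 45) (square-nonneg a)) ⟩
        T + ⟦ 45 ⟧ * (a * a)             ≈⟨ T+45a²≈9S ⟩
        ⟦ 9 ⟧ * S                        <⟨ scale-< 8 (-<0⇒< S-z²<0) ⟩
        ⟦ 9 ⟧ * (z * z)                  ≤⟨ x≤x+y (*-nonneg (numeral-nonneg 16) (square-nonneg z)) ⟩
        ⟦ 9 ⟧ * (z * z) + ⟦ 16 ⟧ * (z * z) ≈⟨ 9z²+16z²≈25z² ⟩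
        (⟦ 5 ⟧ * z) * (⟦ 5 ⟧ * z)        ∎
      0<5z : 0# < ⟦ 5 ⟧ * z
      0<5z = begin-strict
        0#          ≈⟨ zeroʳ ⟦ 5 ⟧ ⟨
        ⟦ 5 ⟧ * 0#  <⟨ scale-< 4 0<z ⟩
        ⟦ 5 ⟧ * z   ∎

lemma11 : ∀ {c ℓ₁ ℓ₂ : Level} (R : RealField c ℓ₁ ℓ₂) →
            ∀ (x : Loop.ℝ³ R) → Loop.τ R x → Loop.NT R x
lemma11 R = invariant⊆NT (Loop.τ R) τ-invariant τ⊆guard
  where open Invariance R
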